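{- Let $\mathcal T$ be a completed open tableau of $\mathbb T'$, $\theta$ an open branch of $\mathcal T$, and $\Upsilon$ the set of signed formulas occurring on $\theta$. Let $h$ be a valuation into $\mathfrak M_{4m}$ such that for every propositional variable $p$: $h(p)\in\{\mathbf 1,\mathbf b\}$ if $T(p)\in\Upsilon$; $h(p)\in\{\mathbf 1,\mathbf n\}$ if $F(\neg p)\in\Upsilon$; $h(p)\in\{\mathbf 0,\mathbf n\}$ if $F(p)\in\Upsilon$; $h(p)\in\{\mathbf 0,\mathbf b\}$ if $T(\neg p)\in\Upsilon$ (arbitrary otherwise). Then for every formula $\alpha$: $h(\alpha)\in\{\mathbf 1,\mathbf b\}$ if $T(\alpha)\in\Upsilon$; $h(\alpha)\in\{\mathbf 1,\mathbf n\}$ if $F(\neg\alpha)\in\Upsilon$; $h(\alpha)\in\{\mathbf 0,\mathbf n\}$ if $F(\alpha)\in\Upsilon$; $h(\alpha)\in\{\mathbf 0,\mathbf b\}$ if $T(\neg\alpha)\in\Upsilon$.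
   Context: $\mathfrak M_{4m}$ is the lattice $M_4=\{\mathbf 0,\mathbf n,\mathbf b,\mathbf 1\}$ ($\mathbf 0<\mathbf n,\mathbf b<\mathbf 1$, $\mathbf n,\mathbf b$ incomparable) with $\neg\mathbf 0=\mathbf 1$, $\neg\mathbf 1=\mathbf 0$, $\neg\mathbf n=\mathbf n$, $\neg\mathbf b=\mathbf b$, $\square\mathbf 1=\mathbf 1$, $\square x=\mathbf 0$ for $x\ne\mathbf 1$. Formulas are built from propositional variables with $\vee,\wedge,\neg,\square$; a valuation is a homomorphism $h$ from formulas into $\mathfrak M_{4m}$. Signed formulas: $T(\alpha)$, $F(\alpha)$. Rules of $\mathbb T'$ (premise $\Rightarrow$ conclusion sets separated by $|$): $T(\alpha\vee\beta)\Rightarrow\{T(\alpha)\}|\{T(\beta)\}$; $T(\neg(\alpha\vee\beta))\Rightarrow\{T(\neg\alpha),T(\neg\beta)\}$; $F(\alpha\vee\beta)\Rightarrow\{F(\alpha),F(\beta)\}$; $F(\neg(\alpha\vee\beta))\Rightarrow\{F(\neg\alpha)\}|\{F(\neg\beta)\}$; $T(\alpha\wedge\beta)\Rightarrow\{T(\alpha),T(\beta)\}$; $T(\neg(\alpha\wedge\beta))\Rightarrow\{T(\neg\alpha)\}|\{T(\neg\beta)\}$; $F(\alpha\wedge\beta)\Rightarrow\{F(\alpha)\}|\{F(\beta)\}$; $F(\neg(\alpha\wedge\beta))\Rightarrow\{F(\neg\alpha),F(\neg\beta)\}$; $T(\neg\neg\alpha)\Rightarrow\{T(\alpha)\}$;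 $F(\neg\neg\alpha)\Rightarrow\{F(\alpha)\}$; $T(\square\alpha)\Rightarrow\{T(\alpha),F(\neg\alpha)\}$; $F(\square\alpha)\Rightarrow\{F(\alpha)\}|\{T(\neg\alpha)\}$; $T(\neg\square\alpha)\Rightarrow\{F(\square\alpha)\}$; $F(\neg\square\alpha)\Rightarrow\{T(\square\alpha)\}$. A tableau is a finite tree of signed formulas built from a root by repeatedly choosing a non-closed branch and a signed formula on it that is a rule premise, and extending the branch by one sub-branch per conclusion set. A branch is closed if it contains $T(\gamma)$ and $F(\gamma)$ for some $\gamma$, open otherwise; a tableau is open if some branch is open; it is completed if on every non-closed branch every rule whose premise occurs on the branch has been applied to it along that branch. -}

module Defs where

open import Data.Nat using (ℕ)
open import Data.List using (List; []; _∷_; _++_; map)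
open import Data.List.Membership.Propositional using (_∈_)
open import Data.Product using (Σ; _×_; _,_; proj₁; proj₂; ∃-syntax)
open import Data.Sum using (_⊎_)
open import Relation.Binary.PropositionalEquality using (_≡_)
open import Relation.Nullary using (¬_)

data M4 : Set where
  𝟎 𝐧 𝐛 𝟏 : M4

-- lattice join of M₄ (𝟎 < 𝐧, 𝐛 < 𝟏; 𝐧, 𝐛 incomparable)
_⊔_ : M4 → M4 → M4
𝟎 ⊔ y = y
𝟏 ⊔ y = 𝟏
𝐧 ⊔ 𝟎 = 𝐧
𝐧 ⊔ 𝐧 = 𝐧
𝐧 ⊔ 𝐛 = 𝟏
𝐧 ⊔ 𝟏 = 𝟏
𝐛 ⊔ 𝟎 = 𝐛
𝐛 ⊔ 𝐧 = 𝟏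
𝐛 ⊔ 𝐛 = 𝐛
𝐛 ⊔ 𝟏 = 𝟏

_⊓_ : M4 → M4 → M4
𝟎 ⊓ y = 𝟎
𝟏 ⊓ y = y
𝐧 ⊓ 𝟎 = 𝟎
𝐧 ⊓ 𝐧 = 𝐧
𝐧 ⊓ 𝐛 = 𝟎
𝐧 ⊓ 𝟏 = 𝐧
𝐛 ⊓ 𝟎 = 𝟎
𝐛 ⊓ 𝐧 = 𝟎
𝐛 ⊓ 𝐛 = 𝐛
𝐛 ⊓ 𝟏 = 𝐛

∼_ : M4 → M4
∼ 𝟎 = 𝟏
∼ 𝟏 = 𝟎
∼ 𝐧 = 𝐧
∼ 𝐛 = 𝐛

■_ : M4 → M4
■ 𝟏 = 𝟏
■ 𝟎 = 𝟎
■ 𝐧 = 𝟎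
■ 𝐛 = 𝟎

infixr 6 _∧'_
infixr 5 _∨'_
data Form : Set where
  var   : ℕ → Form
  _∨'_  : Form → Form → Form
  _∧'_  : Form → Form → Form
  ¬'_   : Form → Form
  □_    : Form → Form

record IsValuation (h : Form → M4) : Set where
  field
    hom-∨ : ∀ α β → h (α ∨' β) ≡ h α ⊔ h β
    hom-∧ : ∀ α β → h (α ∧' β) ≡ h α ⊓ h β
    hom-¬ : ∀ α → h (¬' α) ≡ ∼ h α
    hom-□ : ∀ α → h (□ α) ≡ ■ h α

data SF : Set where
  T F : Form → SF

-- Rule φ cs : φ is a premise of a rule of 𝕋' with list of conclusion sets cs
data Rule : SF → List (List SF) → Set where
  T∨  : ∀ α β → Rule (T (α ∨' β)) ((T α ∷ []) ∷ (T β ∷ []) ∷ [])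
  T¬∨ : ∀ α β → Rule (T (¬' (α ∨' β))) ((T (¬' α) ∷ T (¬' β) ∷ []) ∷ [])
  F∨  : ∀ α β → Rule (F (α ∨' β)) ((F α ∷ F β ∷ []) ∷ [])
  F¬∨ : ∀ α β → Rule (F (¬' (α ∨' β))) ((F (¬' α) ∷ []) ∷ (F (¬' β) ∷ []) ∷ [])
  T∧  : ∀ α β → Rule (T (α ∧' β)) ((T α ∷ T β ∷ []) ∷ [])
  T¬∧ : ∀ α β → Rule (T (¬' (α ∧' β))) ((T (¬' α) ∷ []) ∷ (T (¬' β) ∷ []) ∷ [])
  F∧  : ∀ α β → Rule (F (α ∧' β)) ((F α ∷ []) ∷ (F β ∷ []) ∷ [])
  F¬∧ : ∀ α β → Rule (F (¬' (α ∧' β))) ((F (¬' α) ∷ F (¬' β) ∷ []) ∷ [])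
  T¬¬ : ∀ α → Rule (T (¬' ¬' α)) ((T α ∷ []) ∷ [])
  F¬¬ : ∀ α → Rule (F (¬' ¬' α)) ((F α ∷ []) ∷ [])
  T□  : ∀ α → Rule (T (□ α)) ((T α ∷ F (¬' α) ∷ []) ∷ [])
  F□  : ∀ α → Rule (F (□ α)) ((F α ∷ []) ∷ (T (¬' α) ∷ []) ∷ [])
  T¬□ : ∀ α → Rule (T (¬' □ α)) ((F (□ α) ∷ []) ∷ [])
  F¬□ : ∀ α → Rule (F (¬' □ α)) ((T (□ α) ∷ []) ∷ [])

-- A tableau (a finite tree) is represented by the list of its
-- root-to-leaf branches.  A branch records the signed formulas on it
-- (first component, from root to leaf) and the list of premises to which
-- a rule has been applied along that branch (second component).

Branch : Set
Branch = List SF × List SF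

formulas : Branch → List SF
formulas = proj₁

applied : Branch → List SF
applied = proj₂

ClosedList : List SF → Set
ClosedList Γ = Σ Form λ γ → (T γ ∈ Γ) × (F γ ∈ Γ)

Closed : Branch → Set
Closed θ = ClosedList (formulas θ)

extend : SF → Branch → List (List SF) → List Branch
extend φ θ cs = map (λ c → (formulas θ ++ c , φ ∷ applied θ)) cs

data IsTableau (r : SF) : List Branch → Set where
  root : IsTableau r (((r ∷ []) , []) ∷ [])
  step : ∀ bs₁ θ bs₂ φ cs →
         IsTableau r (bs₁ ++ θ ∷ bs₂) →
         ¬ Closed θ →
         φ ∈ formulas θ →
         Rule φ cs →
         IsTableau r (bs₁ ++ extend φ θ cs ++ bs₂)

IsOpenTableau : List Branch → Set
IsOpenTableau bs = ∃[ θ ] (θ ∈ bs × ¬ Closed θ)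

IsCompleted : List Branch → Set
IsCompleted bs = ∀ θ → θ ∈ bs → ¬ Closed θ →
                 ∀ φ cs → φ ∈ formulas θ → Rule φ cs → φ ∈ applied θ

In1b In1n In0n In0b : M4 → Set
In1b x = x ≡ 𝟏 ⊎ x ≡ 𝐛
In1n x = x ≡ 𝟏 ⊎ x ≡ 𝐧
In0n x = x ≡ 𝟎 ⊎ x ≡ 𝐧
In0b x = x ≡ 𝟎 ⊎ x ≡ 𝐛

Conditions : (Form → M4) → List SF → Form → Set
Conditions h Υ α =
  (T α ∈ Υ → In1b (h α)) ×
  (F (¬' α) ∈ Υ → In1n (h α)) ×
  (F α ∈ Υ → In0n (h α)) ×
  (T (¬' α) ∈ Υ → In0b (h α))

-- On a completed open branch every applied rule has left one of its conclusion
-- sets on the branch, so the branch is saturated: a Hintikka set for 𝕋'.  The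
-- four bounds then propagate from the variables to all formulas by induction,
-- because {𝟏,𝐛} and {𝟏,𝐧} are the principal filters of 𝐛 and 𝐧 in M₄,
-- {𝟎,𝐧} and {𝟎,𝐛} the principal ideals, ∼ exchanges ↓𝐛 with ↑𝐛 and ↓𝐧
-- with ↑𝐧, and ■ x is 𝟏 exactly on ↑𝐛 ∩ ↑𝐧.
module Submission where

open import Defs
open import Data.Nat using (ℕ)
open import Data.List using (List; []; _∷_; _++_)
open import Data.List.Membership.Propositional using (_∈_; lose)
open import Data.List.Membership.Propositional.Properties using (∈-++⁺ˡ; ∈-++⁺ʳ; ∈-++⁻; ∈-map⁻)
open import Data.List.Relation.Unary.Any as Any using (Any; here; there)
open import Data.List.Relation.Unary.All as All using (All; []; _∷_)
open import Data.Product as Product using (_×_; _,_)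
open import Data.Sum as Sum using (_⊎_; inj₁; inj₂)
open import Relation.Binary.PropositionalEquality using (_≡_; refl; sym; subst)
open import Relation.Nullary using (¬_)

⊔-In1b : ∀ {x y} → In1b x ⊎ In1b y → In1b (x ⊔ y)
⊔-In1b (inj₁ (inj₁ refl)) = inj₁ refl
⊔-In1b {y = 𝟎} (inj₁ (inj₂ refl)) = inj₂ refl
⊔-In1b {y = 𝐧} (inj₁ (inj₂ refl)) = inj₁ refl
⊔-In1b {y = 𝐛} (inj₁ (inj₂ refl)) = inj₂ refl
⊔-In1b {y = 𝟏} (inj₁ (inj₂ refl)) = inj₁ refl
⊔-In1b {x = 𝟎} (inj₂ p) = p
⊔-In1b {x = 𝟏} (inj₂ p) = inj₁ refl
⊔-In1b {x = 𝐧} (inj₂ (inj₁ refl)) = inj₁ refl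
⊔-In1b {x = 𝐧} (inj₂ (inj₂ refl)) = inj₁ refl
⊔-In1b {x = 𝐛} (inj₂ (inj₁ refl)) = inj₁ refl
⊔-In1b {x = 𝐛} (inj₂ (inj₂ refl)) = inj₂ refl

⊔-In1n : ∀ {x y} → In1n x ⊎ In1n y → In1n (x ⊔ y)
⊔-In1n (inj₁ (inj₁ refl)) = inj₁ refl
⊔-In1n {y = 𝟎} (inj₁ (inj₂ refl)) = inj₂ refl
⊔-In1n {y = 𝐧} (inj₁ (inj₂ refl)) = inj₂ refl
⊔-In1n {y = 𝐛} (inj₁ (inj₂ refl)) = inj₁ refl
⊔-In1n {y = 𝟏} (inj₁ (inj₂ refl)) = inj₁ refl
⊔-In1n {x = 𝟎} (inj₂ p) = p
⊔-In1n {x = 𝟏} (inj₂ p) = inj₁ refl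
⊔-In1n {x = 𝐧} (inj₂ (inj₁ refl)) = inj₁ refl
⊔-In1n {x = 𝐧} (inj₂ (inj₂ refl)) = inj₂ refl
⊔-In1n {x = 𝐛} (inj₂ (inj₁ refl)) = inj₁ refl
⊔-In1n {x = 𝐛} (inj₂ (inj₂ refl)) = inj₁ refl

⊔-In0n : ∀ {x y} → In0n x × In0n y → In0n (x ⊔ y)
⊔-In0n (inj₁ refl , q) = q
⊔-In0n (inj₂ refl , inj₁ refl) = inj₂ refl
⊔-In0n (inj₂ refl , inj₂ refl) = inj₂ refl

⊔-In0b : ∀ {x y} → In0b x × In0b y → In0b (x ⊔ y)
⊔-In0b (inj₁ refl , q) = q
⊔-In0b (inj₂ refl , inj₁ refl) = inj₂ refl
⊔-In0b (inj₂ refl , inj₂ refl) = inj₂ refl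

⊓-In1b : ∀ {x y} → In1b x × In1b y → In1b (x ⊓ y)
⊓-In1b (inj₁ refl , q) = q
⊓-In1b (inj₂ refl , inj₁ refl) = inj₂ refl
⊓-In1b (inj₂ refl , inj₂ refl) = inj₂ refl

⊓-In1n : ∀ {x y} → In1n x × In1n y → In1n (x ⊓ y)
⊓-In1n (inj₁ refl , q) = q
⊓-In1n (inj₂ refl , inj₁ refl) = inj₂ refl
⊓-In1n (inj₂ refl , inj₂ refl) = inj₂ refl

⊓-In0n : ∀ {x y} → In0n x ⊎ In0n y → In0n (x ⊓ y)
⊓-In0n (inj₁ (inj₁ refl)) = inj₁ refl
⊓-In0n {y = 𝟎} (inj₁ (inj₂ refl)) = inj₁ refl
⊓-In0n {y = 𝐧} (inj₁ (inj₂ refl)) = inj₂ refl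
⊓-In0n {y = 𝐛} (inj₁ (inj₂ refl)) = inj₁ refl
⊓-In0n {y = 𝟏} (inj₁ (inj₂ refl)) = inj₂ refl
⊓-In0n {x = 𝟎} (inj₂ p) = inj₁ refl
⊓-In0n {x = 𝟏} (inj₂ p) = p
⊓-In0n {x = 𝐧} (inj₂ (inj₁ refl)) = inj₁ refl
⊓-In0n {x = 𝐧} (inj₂ (inj₂ refl)) = inj₂ refl
⊓-In0n {x = 𝐛} (inj₂ (inj₁ refl)) = inj₁ refl
⊓-In0n {x = 𝐛} (inj₂ (inj₂ refl)) = inj₁ refl

⊓-In0b : ∀ {x y} → In0b x ⊎ In0b y → In0b (x ⊓ y)
⊓-In0b (inj₁ (inj₁ refl)) = inj₁ refl
⊓-In0b {y = 𝟎} (inj₁ (inj₂ refl)) = inj₁ refl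
⊓-In0b {y = 𝐧} (inj₁ (inj₂ refl)) = inj₁ refl
⊓-In0b {y = 𝐛} (inj₁ (inj₂ refl)) = inj₂ refl
⊓-In0b {y = 𝟏} (inj₁ (inj₂ refl)) = inj₂ refl
⊓-In0b {x = 𝟎} (inj₂ p) = inj₁ refl
⊓-In0b {x = 𝟏} (inj₂ p) = p
⊓-In0b {x = 𝐧} (inj₂ (inj₁ refl)) = inj₁ refl
⊓-In0b {x = 𝐧} (inj₂ (inj₂ refl)) = inj₁ refl
⊓-In0b {x = 𝐛} (inj₂ (inj₁ refl)) = inj₁ refl
⊓-In0b {x = 𝐛} (inj₂ (inj₂ refl)) = inj₂ refl

∼-In1b : ∀ {x} → In0b x → In1b (∼ x)
∼-In1b (inj₁ refl) = inj₁ refl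
∼-In1b (inj₂ refl) = inj₂ refl

∼-In1n : ∀ {x} → In0n x → In1n (∼ x)
∼-In1n (inj₁ refl) = inj₁ refl
∼-In1n (inj₂ refl) = inj₂ refl

∼-In0n : ∀ {x} → In1n x → In0n (∼ x)
∼-In0n (inj₁ refl) = inj₁ refl
∼-In0n (inj₂ refl) = inj₂ refl

∼-In0b : ∀ {x} → In1b x → In0b (∼ x)
∼-In0b (inj₁ refl) = inj₁ refl
∼-In0b (inj₂ refl) = inj₂ refl

■-≡𝟏 : ∀ {x} → In1b x × In1n x → ■ x ≡ 𝟏
■-≡𝟏 (inj₁ refl , _) = refl
■-≡𝟏 (inj₂ refl , inj₁ ())
■-≡𝟏 (inj₂ refl , inj₂ ())

■-≡𝟎 : ∀ {x} → In0n x ⊎ In0b x → ■ x ≡ 𝟎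
■-≡𝟎 (inj₁ (inj₁ refl)) = refl
■-≡𝟎 (inj₁ (inj₂ refl)) = refl
■-≡𝟎 (inj₂ (inj₁ refl)) = refl
■-≡𝟎 (inj₂ (inj₂ refl)) = refl

HasConclusion : List SF → List (List SF) → Set
HasConclusion Γ cs = Any (All (_∈ Γ)) cs

Saturated : List SF → Set
Saturated Γ = ∀ {φ cs} → φ ∈ Γ → Rule φ cs → HasConclusion Γ cs

HasConclusion-++⁺ : ∀ {Γ cs} Δ → HasConclusion Γ cs → HasConclusion (Γ ++ Δ) cs
HasConclusion-++⁺ Δ = Any.map (All.map ∈-++⁺ˡ)

HasConclusion-extension : ∀ Γ {c cs} → c ∈ cs → HasConclusion (Γ ++ c) cs
HasConclusion-extension Γ c∈cs = lose c∈cs (All.tabulate (∈-++⁺ʳ Γ))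

Rule-functional : ∀ {φ cs cs′} → Rule φ cs → Rule φ cs′ → cs ≡ cs′
Rule-functional (T∨ α β) (T∨ .α .β) = refl
Rule-functional (T¬∨ α β) (T¬∨ .α .β) = refl
Rule-functional (F∨ α β) (F∨ .α .β) = refl
Rule-functional (F¬∨ α β) (F¬∨ .α .β) = refl
Rule-functional (T∧ α β) (T∧ .α .β) = refl
Rule-functional (T¬∧ α β) (T¬∧ .α .β) = refl
Rule-functional (F∧ α β) (F∧ .α .β) = refl
Rule-functional (F¬∧ α β) (F¬∧ .α .β) = refl
Rule-functional (T¬¬ α) (T¬¬ .α) = refl
Rule-functional (F¬¬ α) (F¬¬ .α) = refl
Rule-functional (T□ α) (T□ .α) = refl
Rule-functional (F□ α) (F□ .α) = refl
Rule-functional (T¬□ α) (T¬□ .α) = refl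
Rule-functional (F¬□ α) (F¬□ .α) = refl

applied⇒HasConclusion : ∀ {r bs θ φ cs} → IsTableau r bs → θ ∈ bs →
                        φ ∈ applied θ → Rule φ cs → HasConclusion (formulas θ) cs
applied⇒HasConclusion root (here refl) ()
applied⇒HasConclusion root (there ())
applied⇒HasConclusion (step bs₁ θ bs₂ φ cs t _ _ R) θ′∈ φ′∈ R′ with ∈-++⁻ bs₁ θ′∈
... | inj₁ θ′∈bs₁ = applied⇒HasConclusion t (∈-++⁺ˡ θ′∈bs₁) φ′∈ R′
... | inj₂ θ′∈rest with ∈-++⁻ (extend φ θ cs) θ′∈rest
...   | inj₂ θ′∈bs₂ = applied⇒HasConclusion t (∈-++⁺ʳ bs₁ (there θ′∈bs₂)) φ′∈ R′
...   | inj₁ θ′∈ext with ∈-map⁻ _ θ′∈ext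
...     | c , c∈cs , refl with φ′∈
...       | here refl rewrite Rule-functional R′ R = HasConclusion-extension (formulas θ) c∈cs
...       | there φ′∈θ = HasConclusion-++⁺ c
                           (applied⇒HasConclusion t (∈-++⁺ʳ bs₁ (here refl)) φ′∈θ R′)

completed-open⇒Saturated : ∀ {r bs θ} → IsTableau r bs → IsCompleted bs →
                           θ ∈ bs → ¬ Closed θ → Saturated (formulas θ)
completed-open⇒Saturated t completed θ∈ θ-open φ∈ R =
  applied⇒HasConclusion t θ∈ (completed _ θ∈ θ-open _ _ φ∈ R) R

only : ∀ {Γ a} → HasConclusion Γ ((a ∷ []) ∷ []) → a ∈ Γ
only (here (a∈ ∷ [])) = a∈

both : ∀ {Γ a b} → HasConclusion Γ ((a ∷ b ∷ []) ∷ []) → a ∈ Γ × b ∈ Γ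
both (here (a∈ ∷ b∈ ∷ [])) = a∈ , b∈

either : ∀ {Γ a b} → HasConclusion Γ ((a ∷ []) ∷ (b ∷ []) ∷ []) → a ∈ Γ ⊎ b ∈ Γ
either (here (a∈ ∷ [])) = inj₁ a∈
either (there (here (b∈ ∷ []))) = inj₂ b∈

-- Conditions h Γ α unfolds to Bounds Γ α (h α); abstracting the value lets one
-- transport along the homomorphism equations once per connective.
Bounds : List SF → Form → M4 → Set
Bounds Γ α x =
  (T α ∈ Γ → In1b x) × (F (¬' α) ∈ Γ → In1n x) × (F α ∈ Γ → In0n x) × (T (¬' α) ∈ Γ → In0b x)

module Saturated⇒Conditions {Γ} (sat : Saturated Γ) {h} (hom : IsValuation h)
                            (atoms : ∀ p → Conditions h Γ (var p)) where
  open IsValuation hom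

  conditions : ∀ α → Conditions h Γ α
  conditions (var p) = atoms p
  conditions (α ∨' β) with conditions α | conditions β
  ... | Tα , F¬α , Fα , T¬α | Tβ , F¬β , Fβ , T¬β =
    subst (Bounds Γ (α ∨' β)) (sym (hom-∨ α β))
      ( (λ m → ⊔-In1b (Sum.map Tα Tβ (either (sat m (T∨ α β)))))
      , (λ m → ⊔-In1n (Sum.map F¬α F¬β (either (sat m (F¬∨ α β)))))
      , (λ m → ⊔-In0n (Product.map Fα Fβ (both (sat m (F∨ α β)))))
      , (λ m → ⊔-In0b (Product.map T¬α T¬β (both (sat m (T¬∨ α β))))) )
  conditions (α ∧' β) with conditions α | conditions β
  ... | Tα , F¬α , Fα , T¬α | Tβ , F¬β , Fβ , T¬β =
    subst (Bounds Γ (α ∧' β)) (sym (hom-∧ α β))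
      ( (λ m → ⊓-In1b (Product.map Tα Tβ (both (sat m (T∧ α β)))))
      , (λ m → ⊓-In1n (Product.map F¬α F¬β (both (sat m (F¬∧ α β)))))
      , (λ m → ⊓-In0n (Sum.map Fα Fβ (either (sat m (F∧ α β)))))
      , (λ m → ⊓-In0b (Sum.map T¬α T¬β (either (sat m (T¬∧ α β))))) )
  conditions (¬' α) with conditions α
  ... | Tα , F¬α , Fα , T¬α =
    subst (Bounds Γ (¬' α)) (sym (hom-¬ α))
      ( (λ m → ∼-In1b (T¬α m))
      , (λ m → ∼-In1n (Fα (only (sat m (F¬¬ α)))))
      , (λ m → ∼-In0n (F¬α m))
      , (λ m → ∼-In0b (Tα (only (sat m (T¬¬ α))))) )
  conditions (□ α) with conditions α
  ... | Tα , F¬α , Fα , T¬α =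
    subst (Bounds Γ (□ α)) (sym (hom-□ α))
      ( (λ m → inj₁ (■-top m))
      , (λ m → inj₁ (■-top (only (sat m (F¬□ α)))))
      , (λ m → inj₁ (■-bot m))
      , (λ m → inj₁ (■-bot (only (sat m (T¬□ α))))) )
    where
    ■-top : T (□ α) ∈ Γ → ■ h α ≡ 𝟏
    ■-top m = ■-≡𝟏 (Product.map Tα F¬α (both (sat m (T□ α))))

    ■-bot : F (□ α) ∈ Γ → ■ h α ≡ 𝟎
    ■-bot m = ■-≡𝟎 (Sum.map Fα T¬α (either (sat m (F□ α))))

proposition6p5 : (r : SF) (𝒯 : List Branch) → IsTableau r 𝒯 → IsCompleted 𝒯 → IsOpenTableau 𝒯 →
    (θ : Branch) → θ ∈ 𝒯 → ¬ Closed θ →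
    (h : Form → M4) → IsValuation h →
    (∀ (p : ℕ) → Conditions h (formulas θ) (var p)) →
    ∀ (α : Form) → Conditions h (formulas θ) α
proposition6p5 _ _ t completed _ θ θ∈𝒯 θ-open h hom atoms =
  Saturated⇒Conditions.conditions (completed-open⇒Saturated t completed θ∈𝒯 θ-open) hom atoms
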